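{- Let $K_v$ be a finite extension of $\mathbb{Q}_p$ with ring of integers $\mathcal{O}_v$, let $\mathcal{D}$ be a PD-nice differential operator of order $N$, and let $a_0,\dots,a_{N-1}\in\mathcal{O}_v$. Then there is a unique sequence $a_N,a_{N+1},\dots$ of elements of $\mathcal{O}_v$ such that $f=\sum_{i=0}^\infty a_i\frac{t^i}{i!}\in\mathcal{O}_v[[t]]^{\mathrm{PD}}$ satisfies $\mathcal{D}(f)=0$.
   Context: $\mathcal{O}_v[[t]]^{\mathrm{PD}}$ is the ring of divided power series $\sum_{i\ge0}a_i\frac{t^i}{i!}$ with $a_i\in\mathcal{O}_v$. A differential operator $\sum_{i=0}^Ng_i(t)\frac{d^i}{dt^i}$ with coefficients $g_i\in K_v((t))$ is PD-nice of order $N$ if each $g_i\in\mathcal{O}_v[[t]]^{\mathrm{PD}}$ and $g_N\in(\mathcal{O}_v[[t]]^{\mathrm{PD}})^\times$. -}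

module Defs where

open import Level using (Level)
open import Data.Nat using (ℕ; zero; suc; _∸_) renaming (_+_ to _+ℕ_)
open import Data.Nat.Combinatorics using (_C_)
open import Data.Fin using (Fin; toℕ; fromℕ)
open import Data.Product using (∃; _×_)
open import Algebra.Bundles using (CommutativeRing)

-- Divided power series over a commutative ring R (the ring O_v).
-- A divided power series  Σ a_i t^i / i!  is represented by its coefficient
-- sequence  a : ℕ → Carrier.
module PD {c ℓ : Level} (R : CommutativeRing c ℓ) where
  open CommutativeRing R using (Carrier; _≈_; _+_; _*_; 0#; 1#)

  PDSeries : Set c
  PDSeries = ℕ → Carrier

  _·_ : ℕ → Carrier → Carrier
  zero  · x = 0#
  suc k · x = x + (k · x)

  sumUpTo : ℕ → (ℕ → Carrier) → Carrier
  sumUpTo zero    f = f zero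
  sumUpTo (suc n) f = sumUpTo n f + f (suc n)

  -- multiplication in O_v[[t]]^PD:
  --  (t^i/i!)(t^j/j!) = binom(i+j,i) t^(i+j)/(i+j)!
  _⋆_ : PDSeries → PDSeries → PDSeries
  (f ⋆ g) n = sumUpTo n (λ k → (n C k) · (f k * g (n ∸ k)))

  onePD : PDSeries
  onePD zero    = 1#
  onePD (suc n) = 0#

  _≈PD_ : PDSeries → PDSeries → Set ℓ
  f ≈PD g = ∀ n → f n ≈ g n

  IsUnitPD : PDSeries → Set (c Level.⊔ ℓ)
  IsUnitPD g = ∃ λ h → (g ⋆ h) ≈PD onePD

  -- i-th derivative d^i/dt^i :  d/dt (t^n/n!) = t^(n-1)/(n-1)!
  deriv : ℕ → PDSeries → PDSeries
  deriv i f n = f (i +ℕ n)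

  sumFin : (m : ℕ) → (Fin m → PDSeries) → PDSeries
  sumFin zero    F n = 0#
  sumFin (suc m) F n = F Data.Fin.zero n + sumFin m (λ j → F (Data.Fin.suc j)) n

  applyOp : (N : ℕ) → (Fin (suc N) → PDSeries) → PDSeries → PDSeries
  applyOp N g f = sumFin (suc N) (λ i → g i ⋆ deriv (toℕ i) f)

  -- PD-nice of order N: coefficients in O_v[[t]]^PD (built into the type)
  -- and leading coefficient a unit of O_v[[t]]^PD.
  PDNice : (N : ℕ) → (Fin (suc N) → PDSeries) → Set (c Level.⊔ ℓ)
  PDNice N g = IsUnitPD (g (fromℕ N))

-- Read coefficientwise, the n-th coefficient of D(f) is g_N(0)·f_{N+n} plus
-- terms involving only f_j with j < N + n, and g_N(0) is a unit because the
-- constant term of a product of divided power series is the product of the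
-- constant terms. So D(f) = 0 determines f_{N+n} from the earlier
-- coefficients: the solutions with initial values a₀ are exactly the fixed
-- points of a causal operator on sequences, and a causal operator has a unique
-- fixed point, read off the diagonal of its iterates.
module Submission where

open import Defs
open import Level using (Level; _⊔_)
open import Data.Nat
  using (ℕ; zero; suc; s≤s; _<_; _≤_; _∸_; _<?_; s≤s⁻¹; _≤′_; ≤′-refl; ≤′-step)
  renaming (_+_ to _+ℕ_)
open import Data.Nat.Properties
  using (≤-refl; ≤-reflexive; ≤-trans; <-≤-trans; ≤′⇒≤; ≤⇒≤′; ≮⇒≥; m+n≮m; +-suc;
         +-monoˡ-≤; +-monoʳ-<; m∸n≤m; m+n∸m≡n; m+[n∸m]≡n)
open import Data.Nat.Induction using (<-rec)
open import Data.Nat.Combinatorics using (_C_)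
open import Data.Fin using (Fin; toℕ; fromℕ; fromℕ<; inject₁)
open import Data.Fin.Properties using (toℕ-fromℕ; toℕ-fromℕ<; fromℕ<-toℕ; inject₁ℕ<; toℕ<n)
open import Data.Product using (∃; _×_; _,_; proj₂)
open import Data.Empty using (⊥-elim)
open import Relation.Nullary using (yes; no)
open import Relation.Binary.Bundles using (Setoid)
open import Relation.Binary.PropositionalEquality as ≡ using (_≡_)
open import Algebra.Bundles using (CommutativeRing)
import Algebra.Properties.Ring as RingProperties
import Relation.Binary.Reasoning.Setoid as SetoidReasoning

module CausalFixedPoint {a ℓ} (S : Setoid a ℓ) where
  open Setoid S renaming (Carrier to A)

  _≈[<_]_ : (ℕ → A) → ℕ → (ℕ → A) → Set ℓ
  f ≈[< n ] g = ∀ {i} → i < n → f i ≈ g i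

  ≈[<]-weaken : ∀ {m n} {f g : ℕ → A} → m ≤ n → f ≈[< n ] g → f ≈[< m ] g
  ≈[<]-weaken m≤n f≈g i<m = f≈g (<-≤-trans i<m m≤n)

  Causal : ((ℕ → A) → ℕ → A) → Set (a ⊔ ℓ)
  Causal F = ∀ {f g} n → f ≈[< n ] g → F f n ≈ F g n

  module _ {F : (ℕ → A) → ℕ → A} (causal : Causal F) where

    fixedPoints-agree : ∀ {f g} → (∀ n → f n ≈ F f n) → (∀ n → g n ≈ F g n) →
                        ∀ n → f n ≈ g n
    fixedPoints-agree f-fixed g-fixed = <-rec _ λ n f≈g →
      trans (f-fixed n) (trans (causal n f≈g) (sym (g-fixed n)))

    module Construction (seed : ℕ → A) where

      approx : ℕ → ℕ → A
      approx zero    = seed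
      approx (suc k) = F (approx k)

      approx-step : ∀ k → approx (suc k) ≈[< k ] approx k
      approx-step zero    ()
      approx-step (suc k) i<1+k =
        causal _ (λ j<i → approx-step k (<-≤-trans j<i (s≤s⁻¹ i<1+k)))

      approx-stable : ∀ {k m} → k ≤′ m → approx m ≈[< k ] approx k
      approx-stable ≤′-refl        _   = refl
      approx-stable (≤′-step k≤′m) i<k =
        trans (approx-step _ (<-≤-trans i<k (≤′⇒≤ k≤′m))) (approx-stable k≤′m i<k)

      fix : ℕ → A
      fix n = approx (suc n) n

      fix-≈[<]-approx : ∀ k → fix ≈[< k ] approx k
      fix-≈[<]-approx k i<k = sym (approx-stable (≤⇒≤′ i<k) ≤-refl)

      fix-isFixedPoint : ∀ n → fix n ≈ F fix n
      fix-isFixedPoint n = causal n (λ i<n → sym (fix-≈[<]-approx n i<n))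

module PDOperators {c ℓ} (R : CommutativeRing c ℓ) where
  open CommutativeRing R
  open RingProperties ring using (-‿distribʳ-*; +-inverseʳ-unique)
  open SetoidReasoning setoid
  open PD R
  open CausalFixedPoint setoid

  linear-root : ∀ {x u} → x * u ≈ 1# → ∀ r → r + x * - (u * r) ≈ 0#
  linear-root {x} {u} xu≈1 r = begin
    r + x * - (u * r)   ≈⟨ +-congˡ (-‿distribʳ-* x (u * r)) ⟨
    r + - (x * (u * r)) ≈⟨ +-congˡ (-‿cong (*-assoc x u r)) ⟨
    r + - (x * u * r)   ≈⟨ +-congˡ (-‿cong (trans (*-congʳ xu≈1) (*-identityˡ r))) ⟩
    r + - r             ≈⟨ -‿inverseʳ r ⟩
    0#                  ∎

  linear-root-unique : ∀ {x u} → x * u ≈ 1# → ∀ r y → r + x * y ≈ 0# → y ≈ - (u * r)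
  linear-root-unique {x} {u} xu≈1 r y r+xy≈0 = begin
    y           ≈⟨ *-identityˡ y ⟨
    1# * y      ≈⟨ *-congʳ (trans (*-comm u x) xu≈1) ⟨
    u * x * y   ≈⟨ *-assoc u x y ⟩
    u * (x * y) ≈⟨ *-congˡ (+-inverseʳ-unique r (x * y) r+xy≈0) ⟩
    u * - r     ≈⟨ -‿distribʳ-* u r ⟨
    - (u * r)   ∎

  ·-cong : ∀ k {x y} → x ≈ y → k · x ≈ k · y
  ·-cong zero    x≈y = refl
  ·-cong (suc k) x≈y = +-cong x≈y (·-cong k x≈y)

  sumUpTo-cong : ∀ n {φ ψ : ℕ → Carrier} → (∀ k → φ k ≈ ψ k) → sumUpTo n φ ≈ sumUpTo n ψ
  sumUpTo-cong zero    φ≈ψ = φ≈ψ 0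
  sumUpTo-cong (suc n) φ≈ψ = +-cong (sumUpTo-cong n φ≈ψ) (φ≈ψ (suc n))

  sumUpTo-suc : ∀ n (φ : ℕ → Carrier) → sumUpTo (suc n) φ ≈ φ 0 + sumUpTo n (λ k → φ (suc k))
  sumUpTo-suc zero    φ = refl
  sumUpTo-suc (suc n) φ = trans (+-congʳ (sumUpTo-suc n φ)) (+-assoc _ _ _)

  sumFin-cong : ∀ m n {F G : Fin m → PDSeries} → (∀ i → F i n ≈ G i n) → sumFin m F n ≈ sumFin m G n
  sumFin-cong zero    n F≈G = refl
  sumFin-cong (suc m) n F≈G = +-cong (F≈G Data.Fin.zero) (sumFin-cong m n (λ i → F≈G (Data.Fin.suc i)))

  sumFin-last : ∀ m n (F : Fin (suc m) → PDSeries) →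
                sumFin (suc m) F n ≈ sumFin m (λ i → F (inject₁ i)) n + F (fromℕ m) n
  sumFin-last zero    n F = trans (+-identityʳ _) (sym (+-identityˡ _))
  sumFin-last (suc m) n F =
    trans (+-congˡ (sumFin-last m n (λ i → F (Data.Fin.suc i)))) (sym (+-assoc _ _ _))

  ⋆-tail : PDSeries → PDSeries → PDSeries
  ⋆-tail h f zero    = 0#
  ⋆-tail h f (suc n) = sumUpTo n (λ k → (suc n C suc k) · (h (suc k) * f (n ∸ k)))

  ⋆-head-tail : ∀ h f n → (h ⋆ f) n ≈ ⋆-tail h f n + h 0 * f n
  ⋆-head-tail h f zero    = trans (+-identityʳ _) (sym (+-identityˡ _))
  ⋆-head-tail h f (suc n) = begin
    (h ⋆ f) (suc n)                             ≈⟨ sumUpTo-suc n _ ⟩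
    1 · (h 0 * f (suc n)) + ⋆-tail h f (suc n)  ≈⟨ +-comm _ _ ⟩
    ⋆-tail h f (suc n) + 1 · (h 0 * f (suc n))  ≈⟨ +-congˡ (+-identityʳ _) ⟩
    ⋆-tail h f (suc n) + h 0 * f (suc n)        ∎

  ⋆-causal : ∀ h {f f′} n → f ≈[< suc n ] f′ → (h ⋆ f) n ≈ (h ⋆ f′) n
  ⋆-causal h n f≈f′ = sumUpTo-cong n λ k →
    ·-cong (n C k) (*-congˡ (f≈f′ (s≤s (m∸n≤m n k))))

  ⋆-tail-causal : ∀ h {f f′} n → f ≈[< n ] f′ → ⋆-tail h f n ≈ ⋆-tail h f′ n
  ⋆-tail-causal h zero    f≈f′ = refl
  ⋆-tail-causal h (suc n) f≈f′ = sumUpTo-cong n λ k →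
    ·-cong (suc n C suc k) (*-congˡ (f≈f′ (s≤s (m∸n≤m n k))))

  deriv-causal : ∀ d {f f′ : PDSeries} n → f ≈[< d +ℕ n ] f′ → deriv d f ≈[< n ] deriv d f′
  deriv-causal d n f≈f′ i<n = f≈f′ (+-monoʳ-< d i<n)

  IsUnitPD⇒invertible₀ : ∀ {h} → IsUnitPD h → ∃ λ u → h 0 * u ≈ 1#
  IsUnitPD⇒invertible₀ (v , hv≈1) = v 0 , trans (sym (+-identityʳ _)) (hv≈1 0)

  module Operator (N : ℕ) (g : Fin (suc N) → PDSeries) where

    leading : PDSeries
    leading = g (fromℕ N)

    lowerTerms : PDSeries → PDSeries
    lowerTerms f n = sumFin N (λ i → g (inject₁ i) ⋆ deriv (toℕ (inject₁ i)) f) n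
                   + ⋆-tail leading (deriv N f) n

    applyOp-split : ∀ f n → applyOp N g f n ≈ lowerTerms f n + leading 0 * f (N +ℕ n)
    applyOp-split f n = begin
      applyOp N g f n
        ≈⟨ sumFin-last N n (λ i → g i ⋆ deriv (toℕ i) f) ⟩
      lower + (leading ⋆ deriv (toℕ (fromℕ N)) f) n
        ≡⟨ ≡.cong (λ d → lower + (leading ⋆ deriv d f) n) (toℕ-fromℕ N) ⟩
      lower + (leading ⋆ deriv N f) n
        ≈⟨ +-congˡ (⋆-head-tail leading (deriv N f) n) ⟩
      lower + (⋆-tail leading (deriv N f) n + leading 0 * f (N +ℕ n))
        ≈⟨ +-assoc _ _ _ ⟨
      lowerTerms f n + leading 0 * f (N +ℕ n) ∎
      where lower = sumFin N (λ i → g (inject₁ i) ⋆ deriv (toℕ (inject₁ i)) f) n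

    lowerTerms-causal : ∀ {f f′} n → f ≈[< N +ℕ n ] f′ → lowerTerms f n ≈ lowerTerms f′ n
    lowerTerms-causal n f≈f′ = +-cong
      (sumFin-cong N n λ i → ⋆-causal _ n
        (deriv-causal _ (suc n) (≈[<]-weaken (lower-order i) f≈f′)))
      (⋆-tail-causal leading n (deriv-causal N n f≈f′))
      where
      lower-order : ∀ i → toℕ (inject₁ i) +ℕ suc n ≤ N +ℕ n
      lower-order i = ≤-trans (≤-reflexive (+-suc _ n)) (+-monoˡ-≤ n (inject₁ℕ< i))

    module InitialValueProblem {u} (invertible : leading 0 * u ≈ 1#) (a₀ : Fin N → Carrier) where

      IsSolution : PDSeries → Set ℓ
      IsSolution f = (∀ i → f (toℕ i) ≈ a₀ i) × applyOp N g f ≈PD (λ _ → 0#)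

      step : PDSeries → PDSeries
      step f j with j <? N
      ... | yes j<N = a₀ (fromℕ< j<N)
      ... | no  _   = - (u * lowerTerms f (j ∸ N))

      step-initial : ∀ f i → step f (toℕ i) ≡ a₀ i
      step-initial f i with toℕ i <? N
      ... | yes i<N = ≡.cong a₀ (fromℕ<-toℕ i i<N)
      ... | no  i≮N = ⊥-elim (i≮N (toℕ<n i))

      step-higher : ∀ f n → step f (N +ℕ n) ≡ - (u * lowerTerms f n)
      step-higher f n with N +ℕ n <? N
      ... | yes N+n<N = ⊥-elim (m+n≮m N n N+n<N)
      ... | no  _     = ≡.cong (λ m → - (u * lowerTerms f m)) (m+n∸m≡n N n)

      step-causal : Causal step
      step-causal j f≈f′ with j <? N
      ... | yes _   = refl
      ... | no  j≮N = -‿cong (*-congˡ (lowerTerms-causal (j ∸ N)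
                        (≈[<]-weaken (≤-reflexive (m+[n∸m]≡n (≮⇒≥ j≮N))) f≈f′)))

      data Position : ℕ → Set where
        initial : (i : Fin N) → Position (toℕ i)
        higher  : (n : ℕ) → Position (N +ℕ n)

      position : ∀ j → Position j
      position j with j <? N
      ... | yes j<N = ≡.subst Position (toℕ-fromℕ< j<N) (initial (fromℕ< j<N))
      ... | no  j≮N = ≡.subst Position (m+[n∸m]≡n (≮⇒≥ j≮N)) (higher (j ∸ N))

      solution⇒fixedPoint : ∀ f → IsSolution f → ∀ j → f j ≈ step f j
      solution⇒fixedPoint f (f₀ , Df≈0) j with position j
      ... | initial i = trans (f₀ i) (reflexive (≡.sym (step-initial f i)))
      ... | higher n  = begin
        f (N +ℕ n)               ≈⟨ linear-root-unique invertible _ _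
                                      (trans (sym (applyOp-split f n)) (Df≈0 n)) ⟩
        - (u * lowerTerms f n)   ≡⟨ step-higher f n ⟨
        step f (N +ℕ n)          ∎

      fixedPoint⇒solution : ∀ f → (∀ j → f j ≈ step f j) → IsSolution f
      fixedPoint⇒solution f f-fixed = f₀ , Df≈0
        where
        f₀ : ∀ i → f (toℕ i) ≈ a₀ i
        f₀ i = trans (f-fixed (toℕ i)) (reflexive (step-initial f i))

        Df≈0 : applyOp N g f ≈PD (λ _ → 0#)
        Df≈0 n = begin
          applyOp N g f n                                   ≈⟨ applyOp-split f n ⟩
          lowerTerms f n + leading 0 * f (N +ℕ n)           ≈⟨ +-congˡ (*-congˡ
                                                                 (trans (f-fixed (N +ℕ n)) (reflexive (step-higher f n)))) ⟩
          lowerTerms f n + leading 0 * - (u * lowerTerms f n) ≈⟨ linear-root invertible _ ⟩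
          0#                                                ∎

proposition5p13 : {c ℓ : Level} (R : CommutativeRing c ℓ) (N : ℕ)
    (g : Fin (suc N) → PD.PDSeries R) → PD.PDNice R N g →
    (a₀ : Fin N → CommutativeRing.Carrier R) →
    ∃ λ (a : PD.PDSeries R) →
      ((∀ (i : Fin N) → CommutativeRing._≈_ R (a (toℕ i)) (a₀ i))
       × PD._≈PD_ R (PD.applyOp R N g a) (λ _ → CommutativeRing.0# R))
      × (∀ (b : PD.PDSeries R) →
           (∀ (i : Fin N) → CommutativeRing._≈_ R (b (toℕ i)) (a₀ i)) →
           PD._≈PD_ R (PD.applyOp R N g b) (λ _ → CommutativeRing.0# R) →
           PD._≈PD_ R b a)
proposition5p13 R N g nice a₀ =
  fix , fixedPoint⇒solution fix fix-isFixedPoint ,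
  λ b b₀ Db≈0 → fixedPoints-agree step-causal
                  (solution⇒fixedPoint b (b₀ , Db≈0)) fix-isFixedPoint
  where
  open CommutativeRing R using (setoid; 0#)
  open PDOperators R
  open Operator N g
  open InitialValueProblem (proj₂ (IsUnitPD⇒invertible₀ nice)) a₀
  open CausalFixedPoint setoid
  open Construction step-causal (λ _ → 0#)
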